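{- Let $n\ge0$. The kernel of the map $\Phi_3$, defined on functions $f:V^G_n\to\mathbb C$ by $\Phi_3f(y)=\frac13\sum_{x\sim_{J_n}y}f(x)$ for $y\in V^H_n$, is the eigenspace of $\Delta^G_n$ with eigenvalue $-\frac32$.
   Context: Let $p_1,p_2,p_3$ be the vertices of a triangle in the plane, $p_0=\frac13(p_1+p_2+p_3)$, $F_j(x)=\frac12(x+p_j)$, $F_w=F_{w_1}\circ\cdots\circ F_{w_n}$ for $w\in\{1,2,3\}^n$. $V^G_n=\{F_w(p_j):|w|=n,\ j=1,2,3\}$, $V^H_n=\{F_w(p_0):|w|=n\}$. The graph $G_n$ has vertex set $V^G_n$, distinct $x,y$ adjacent iff $x=F_w(p_j)$, $y=F_w(p_k)$ for some length-$n$ word $w$; its Laplacian is $\Delta^G_nf(x)=\frac1{\deg(x)}\sum_{y\sim x}(f(y)-f(x))$. The graph $J_n$ has vertex set $V^G_n\cup V^H_n$ with edges exactly between $F_w(p_0)$ and $F_w(p_j)$, $j=1,2,3$; $\sim_{J_n}$ denotes adjacency in $J_n$. -}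

module Defs where

open import Level using (Level; _⊔_)
open import Data.Nat as ℕ using (ℕ; zero; suc; _^_)
open import Data.Fin as Fin using (Fin; zero)
open import Data.Vec using (Vec; []; _∷_)
open import Data.List using (List; []; _∷_; map; concatMap; filter; deduplicate; length; foldr)
open import Data.List.Base using (allFin)
open import Data.Product using (_×_; _,_)
open import Data.Product.Properties using (≡-dec)
open import Relation.Nullary using (¬_; ¬?)
open import Relation.Binary.PropositionalEquality using (_≡_)
open import Relation.Binary using (DecidableEquality)
open import Algebra.Bundles using (CommutativeRing)

-- Scalars: a field of characteristic zero (ℂ is one; agda-stdlib has no ℂ).
-- The inverse is total; it is only specified on nonzero elements.

ιR : ∀ {c ℓ} (R : CommutativeRing c ℓ) → ℕ → CommutativeRing.Carrier R
ιR R zero    = CommutativeRing.0# R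
ιR R (ℕ.suc k) = CommutativeRing._+_ R (CommutativeRing.1# R) (ιR R k)

record Char0Field (c ℓ : Level) : Set (Level.suc (c ⊔ ℓ)) where
  field
    commRing : CommutativeRing c ℓ
  open CommutativeRing commRing public hiding (ring)
  field
    _⁻¹     : Carrier → Carrier
    inverse : ∀ x → ¬ (x ≈ 0#) → x * (x ⁻¹) ≈ 1#
    nontrivial : ¬ (1# ≈ 0#)
    char0 : ∀ k → ¬ (ιR commRing (ℕ.suc k) ≈ 0#)

  ι : ℕ → Carrier
  ι = ιR commRing

  Σ[_] : List Carrier → Carrier
  Σ[ xs ] = foldr _+_ 0# xs

-- Points of the triangle, in barycentric coordinates w.r.t. (p₁,p₂,p₃),
-- scaled by 3·2ⁿ at level n (so every point of V^G_n ∪ V^H_n is a triple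
-- of naturals).  Since p₁,p₂,p₃ are affinely independent, two points are
-- equal iff their barycentric coordinates are equal.

Pt : Set
Pt = ℕ × ℕ × ℕ

_≟Pt_ : DecidableEquality Pt
_≟Pt_ = ≡-dec ℕ._≟_ (≡-dec ℕ._≟_ ℕ._≟_)

addAt : ℕ → Fin 3 → Pt → Pt
addAt m zero             (a , b , c) = (m ℕ.+ a , b , c)
addAt m (Fin.suc zero)     (a , b , c) = (a , m ℕ.+ b , c)
addAt m (Fin.suc (Fin.suc zero)) (a , b , c) = (a , b , m ℕ.+ c)

-- vertices p₁,p₂,p₃ (indexed by Fin 3) and barycenter p₀, scaled by 3
corner : Fin 3 → Pt
corner j = addAt 3 j (0 , 0 , 0)

p₀ : Pt
p₀ = (1 , 1 , 1)

Word : ℕ → Set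
Word n = Vec (Fin 3) n

-- F_w x for |w| = n, with x given at scale 3 and result at scale 3·2ⁿ:
-- F_{j w'} x = ½(F_{w'} x + p_j), which at scale 3·2^(k+1) reads
-- (F_{w'} x at scale 3·2^k) + 3·2^k · e_j.
F : (n : ℕ) → Word n → Pt → Pt
F zero    []      x = x
F (ℕ.suc n) (j ∷ w) x = addAt (3 ℕ.* 2 ^ n) j (F n w x)

words : (n : ℕ) → List (Word n)
words zero    = [] ∷ []
words (ℕ.suc n) = concatMap (λ j → map (j ∷_) (words n)) (allFin 3)

fins : List (Fin 3)
fins = allFin 3

dedup : List Pt → List Pt
dedup = deduplicate _≟Pt_

nbrG : (n : ℕ) → Pt → List Pt
nbrG n x = dedup (filter (λ y → ¬? (y ≟Pt x))
  (concatMap (λ w → concatMap (λ j →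
     filter (λ _ → F n w (corner j) ≟Pt x)
       (map (λ k → F n w (corner k)) fins)) fins) (words n)))

degG : ℕ → Pt → ℕ
degG n x = length (nbrG n x)

nbrJ : (n : ℕ) → Pt → List Pt
nbrJ n y = dedup (concatMap (λ w →
  filter (λ _ → F n w p₀ ≟Pt y) (map (λ j → F n w (corner j)) fins)) (words n))

module _ {c ℓ} (K : Char0Field c ℓ) where
  open Char0Field K

  ΔG : (n : ℕ) → (Pt → Carrier) → Pt → Carrier
  ΔG n f x = (ι (degG n x) ⁻¹) * Σ[ map (λ y → f y - f x) (nbrG n x) ]

  Φ₃ : (n : ℕ) → (Pt → Carrier) → Pt → Carrier
  Φ₃ n f y = (ι 3 ⁻¹) * Σ[ map f (nbrJ n y) ]

  InKerΦ₃ : (n : ℕ) → (Pt → Carrier) → Set ℓ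
  InKerΦ₃ n f = ∀ (w : Word n) → Φ₃ n f (F n w p₀) ≈ 0#

  InEigenspace : (n : ℕ) → Carrier → (Pt → Carrier) → Set ℓ
  InEigenspace n λ′ f = ∀ (w : Word n) (j : Fin 3) →
    ΔG n f (F n w (corner j)) ≈ λ′ * f (F n w (corner j))

  minus3/2 : Carrier
  minus3/2 = - (ι 3 * (ι 2 ⁻¹))

module Submission where

-- Every vertex x of G_n is a corner of one cell F_w(triangle) or, at a junction, of exactly two,
-- and its neighbours are the other corners of those cells.  Writing s(w) for the sum of f over the
-- corners of w, this gives  Δf(x) + (3/2) f(x) = (Σ_{w ∋ x} s(w)) / deg x.  Hence f ∈ ker Φ₃, i.e.
-- s ≡ 0, is an eigenfunction.  Conversely, for an eigenfunction s(w) + s(w′) = 0 across every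
-- junction; the three subcells u1, u2, u3 of a cell u meet pairwise at junctions, which forces
-- 2 s(u1) = 0 (for n = 0 the single cell has no junction and s = 0 directly).

open import Defs
open import Data.Nat using (ℕ)
open import Data.Product using (_×_; _,_)

module Geometry where

  open import Data.Nat using (ℕ; zero; suc; _+_; _*_; _^_)
  open import Data.Nat.Properties
    using ( +-assoc; +-commutativeSemigroup; +-identityʳ; +-cancelˡ-≡
          ; m+n≡0⇒m≡0; m+n≡0⇒n≡0; m*n≡0⇒m≡0∨n≡0; m^n≡0⇒m≡0)
  open import Data.Nat.Tactic.RingSolver using (solve-∀)
  open import Algebra.Properties.CommutativeSemigroup +-commutativeSemigroup using (x∙yz≈y∙xz)
  open import Data.Fin as Fin using (Fin; zero; suc; punchIn)
  open import Data.Fin.Properties using (punchInᵢ≢i; punchIn-injective; punchIn-punchOut)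
  open import Data.Vec using ([]; _∷_; replicate; _∷ʳ_)
  open import Data.Vec.Properties using (∷-injectiveˡ; ∷-injectiveʳ; ≡-dec)
  open import Data.Product using (_×_; _,_; Σ)
  open import Data.Sum using (_⊎_; inj₁; inj₂; [_,_]′)
  open import Data.Empty using (⊥-elim)
  open import Function using (case_of_; _∘_)
  open import Function.Bundles using (Equivalence; mk⇔)
  open import Data.List using (List; []; _∷_; map; concatMap; filter; _++_; tabulate)
  open import Data.List.Membership.Propositional using (_∈_; find)
  open import Data.List.Membership.Propositional.Properties
    using ( ∈-++⁺ˡ; ∈-++⁺ʳ; ∈-++⁻; ∈-concatMap⁺; ∈-concatMap⁻; ∈-filter⁺; ∈-filter⁻; ∈-map⁺; ∈-map⁻
          ; ∈-tabulate⁺; ∈-tabulate⁻; ∈-allFin; deduplicate-∈⇔)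
  open import Data.List.Membership.Propositional.Properties.WithK using (unique∧set⇒bag)
  open import Data.List.Relation.Unary.Any as Any using (here; there)
  open import Data.List.Relation.Unary.All as All using (All)
  open import Data.List.Relation.Unary.All.Properties as All using ()
  open import Data.List.Relation.Unary.AllPairs using (_∷_)
  open import Data.List.Relation.Unary.Unique.Propositional using (Unique)
  import Data.List.Relation.Unary.Unique.Propositional.Properties as Unique
  open import Data.List.Relation.Unary.Unique.DecPropositional.Properties _≟Pt_ using (deduplicate-!)
  open import Data.List.Relation.Binary.Permutation.Propositional using (_↭_)
  open import Data.List.Relation.Binary.Disjoint.Propositional using (Disjoint)
  open import Data.List.Relation.Binary.BagAndSetEquality using (∼bag⇒↭)
  open import Relation.Nullary using (¬_; Dec; yes; no; ¬?)
  open import Relation.Binary.PropositionalEquality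
    using (_≡_; _≢_; refl; sym; trans; cong; cong₂; subst; module ≡-Reasoning)

  scale : ℕ → ℕ
  scale n = 3 * 2 ^ n

  scale-suc : ∀ n → scale (suc n) ≡ scale n + scale n
  scale-suc n = lemma (2 ^ n)
    where
    lemma : ∀ k → 3 * (2 * k) ≡ 3 * k + 3 * k
    lemma = solve-∀

  scale+m≢0 : ∀ n m → scale n + m ≢ 0
  scale+m≢0 n m eq with m*n≡0⇒m≡0∨n≡0 3 (m+n≡0⇒m≡0 (scale n) eq)
  ... | inj₂ 2^n≡0 with m^n≡0⇒m≡0 2 n 2^n≡0
  ...   | ()

  vertex : (n : ℕ) → Word n → Fin 3 → Pt
  vertex n w j = F n w (corner j)

  scaledCorner : ℕ → Fin 3 → Pt
  scaledCorner m j = addAt m j (0 , 0 , 0)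

  total : Pt → ℕ
  total (a , b , c) = a + (b + c)

  total-addAt : ∀ m j p → total (addAt m j p) ≡ m + total p
  total-addAt m zero             (a , b , c) = +-assoc m a (b + c)
  total-addAt m (suc zero)       (a , b , c) = lemma m a b c
    where
    lemma : ∀ m a b c → a + ((m + b) + c) ≡ m + (a + (b + c))
    lemma = solve-∀
  total-addAt m (suc (suc zero)) (a , b , c) = lemma m a b c
    where
    lemma : ∀ m a b c → a + (b + (m + c)) ≡ m + (a + (b + c))
    lemma = solve-∀

  total-vertex : ∀ n w c → total (vertex n w c) ≡ scale n
  total-vertex zero    []      zero             = refl
  total-vertex zero    []      (suc zero)       = refl
  total-vertex zero    []      (suc (suc zero)) = refl
  total-vertex (suc n) (j ∷ w) c = begin
    total (addAt (scale n) j (vertex n w c)) ≡⟨ total-addAt (scale n) j (vertex n w c) ⟩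
    scale n + total (vertex n w c)           ≡⟨ cong (scale n +_) (total-vertex n w c) ⟩
    scale n + scale n                        ≡⟨ sym (scale-suc n) ⟩
    scale (suc n)                            ∎
    where open ≡-Reasoning

  coord : Fin 3 → Pt → ℕ
  coord zero             (a , _ , _) = a
  coord (suc zero)       (_ , b , _) = b
  coord (suc (suc zero)) (_ , _ , c) = c

  Pt-ext : ∀ {p q} → (∀ i → coord i p ≡ coord i q) → p ≡ q
  Pt-ext {a , b , c} {a′ , b′ , c′} eq
    with refl ← eq zero | refl ← eq (suc zero) | refl ← eq (suc (suc zero)) = refl

  coord-addAt-≡ : ∀ m j p → coord j (addAt m j p) ≡ m + coord j p
  coord-addAt-≡ m zero             p = refl
  coord-addAt-≡ m (suc zero)       p = refl
  coord-addAt-≡ m (suc (suc zero)) p = refl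

  coord-addAt-≢ : ∀ m {i j} p → i ≢ j → coord i (addAt m j p) ≡ coord i p
  coord-addAt-≢ m {zero}             {zero}             p i≢j = ⊥-elim (i≢j refl)
  coord-addAt-≢ m {zero}             {suc zero}         p i≢j = refl
  coord-addAt-≢ m {zero}             {suc (suc zero)}   p i≢j = refl
  coord-addAt-≢ m {suc zero}         {zero}             p i≢j = refl
  coord-addAt-≢ m {suc zero}         {suc zero}         p i≢j = ⊥-elim (i≢j refl)
  coord-addAt-≢ m {suc zero}         {suc (suc zero)}   p i≢j = refl
  coord-addAt-≢ m {suc (suc zero)}   {zero}             p i≢j = refl
  coord-addAt-≢ m {suc (suc zero)}   {suc zero}         p i≢j = refl
  coord-addAt-≢ m {suc (suc zero)}   {suc (suc zero)}   p i≢j = ⊥-elim (i≢j refl)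

  coord-origin : ∀ i → coord i (0 , 0 , 0) ≡ 0
  coord-origin zero             = refl
  coord-origin (suc zero)       = refl
  coord-origin (suc (suc zero)) = refl

  addAt-injective : ∀ m j {p q} → addAt m j p ≡ addAt m j q → p ≡ q
  addAt-injective m j {p} {q} eq = Pt-ext coords
    where
    coords : ∀ i → coord i p ≡ coord i q
    coords i with i Fin.≟ j
    ... | yes refl = +-cancelˡ-≡ m _ _
          (trans (sym (coord-addAt-≡ m i p)) (trans (cong (coord i) eq) (coord-addAt-≡ m i q)))
    ... | no i≢j = trans (sym (coord-addAt-≢ m p i≢j)) (trans (cong (coord i) eq) (coord-addAt-≢ m q i≢j))

  addAt-comm : ∀ m k i j p → addAt m i (addAt k j p) ≡ addAt k j (addAt m i p)
  addAt-comm m k zero             zero             (a , b , c) = cong (_, b , c) (x∙yz≈y∙xz m k a)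
  addAt-comm m k zero             (suc zero)       (a , b , c) = refl
  addAt-comm m k zero             (suc (suc zero)) (a , b , c) = refl
  addAt-comm m k (suc zero)       zero             (a , b , c) = refl
  addAt-comm m k (suc zero)       (suc zero)       (a , b , c) = cong (λ z → a , z , c) (x∙yz≈y∙xz m k b)
  addAt-comm m k (suc zero)       (suc (suc zero)) (a , b , c) = refl
  addAt-comm m k (suc (suc zero)) zero             (a , b , c) = refl
  addAt-comm m k (suc (suc zero)) (suc zero)       (a , b , c) = refl
  addAt-comm m k (suc (suc zero)) (suc (suc zero)) (a , b , c) = cong (λ z → a , b , z) (x∙yz≈y∙xz m k c)

  addAt-merge : ∀ m k j p → addAt m j (addAt k j p) ≡ addAt (m + k) j p
  addAt-merge m k zero             (a , b , c) = cong (_, b , c) (sym (+-assoc m k a))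
  addAt-merge m k (suc zero)       (a , b , c) = cong (λ z → a , z , c) (sym (+-assoc m k b))
  addAt-merge m k (suc (suc zero)) (a , b , c) = cong (λ z → a , b , z) (sym (+-assoc m k c))

  scaledCorner-suc : ∀ n j → scaledCorner (scale (suc n)) j ≡ addAt (scale n) j (scaledCorner (scale n) j)
  scaledCorner-suc n j =
    trans (cong (λ m → scaledCorner m j) (scale-suc n)) (sym (addAt-merge (scale n) (scale n) j _))

  vertex-replicate : ∀ n j → vertex n (replicate n j) j ≡ scaledCorner (scale n) j
  vertex-replicate zero    j = refl
  vertex-replicate (suc n) j =
    trans (cong (addAt (scale n) j) (vertex-replicate n j)) (sym (scaledCorner-suc n j))

  addAt≢scaledCorner : ∀ n {i j} p m → i ≢ j → addAt (scale n) i p ≢ scaledCorner m j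
  addAt≢scaledCorner n {i} p m i≢j eq = scale+m≢0 n (coord i p) (begin
    scale n + coord i p             ≡⟨ sym (coord-addAt-≡ (scale n) i p) ⟩
    coord i (addAt (scale n) i p)   ≡⟨ cong (coord i) eq ⟩
    coord i (scaledCorner m _)      ≡⟨ coord-addAt-≢ m _ i≢j ⟩
    coord i (0 , 0 , 0)             ≡⟨ coord-origin i ⟩
    0                               ∎)
    where open ≡-Reasoning

  corner-injective : ∀ c d → corner c ≡ corner d → c ≡ d
  corner-injective zero             zero             eq = refl
  corner-injective (suc zero)       (suc zero)       eq = refl
  corner-injective (suc (suc zero)) (suc (suc zero)) eq = refl
  corner-injective zero             (suc zero)       ()
  corner-injective zero             (suc (suc zero)) ()
  corner-injective (suc zero)       zero             ()
  corner-injective (suc zero)       (suc (suc zero)) ()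
  corner-injective (suc (suc zero)) zero             ()
  corner-injective (suc (suc zero)) (suc zero)       ()

  vertex≡scaledCorner⇒ : ∀ n w c j → vertex n w c ≡ scaledCorner (scale n) j → w ≡ replicate n j × c ≡ j
  vertex≡scaledCorner⇒ zero    []      c j eq = refl , corner-injective c j eq
  vertex≡scaledCorner⇒ (suc n) (i ∷ w) c j eq with i Fin.≟ j
  ... | no i≢j  = ⊥-elim (addAt≢scaledCorner n (vertex n w c) _ i≢j eq)
  ... | yes refl with vertex≡scaledCorner⇒ n w c i
                        (addAt-injective (scale n) i (trans eq (scaledCorner-suc n i)))
  ...   | refl , c≡i = refl , c≡i

  m+[a+[b+c]]≡m⇒a,b,c≡0 : ∀ m a b c → m + (a + (b + c)) ≡ m → a ≡ 0 × b ≡ 0 × c ≡ 0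
  m+[a+[b+c]]≡m⇒a,b,c≡0 m a b c eq =
    m+n≡0⇒m≡0 a a+[b+c]≡0 , m+n≡0⇒m≡0 b b+c≡0 , m+n≡0⇒n≡0 b b+c≡0
    where
    a+[b+c]≡0 : a + (b + c) ≡ 0
    a+[b+c]≡0 = +-cancelˡ-≡ m _ 0 (trans eq (sym (+-identityʳ m)))
    b+c≡0 : b + c ≡ 0
    b+c≡0 = m+n≡0⇒n≡0 a a+[b+c]≡0

  total≤coord⇒scaledCorner : ∀ M t j p → total p ≡ M → coord j p ≡ M + t → p ≡ scaledCorner M j
  total≤coord⇒scaledCorner M t zero (a , b , c) tot refl =
    case m+[a+[b+c]]≡m⇒a,b,c≡0 M t b c (trans (sym (+-assoc M t (b + c))) tot) of λ where
      (refl , refl , refl) → refl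
  total≤coord⇒scaledCorner M t (suc zero) (a , b , c) tot refl =
    case m+[a+[b+c]]≡m⇒a,b,c≡0 M t a c (trans (sym (rearrange M t a c)) tot) of λ where
      (refl , refl , refl) → refl
    where
    rearrange : ∀ M t a c → a + ((M + t) + c) ≡ M + (t + (a + c))
    rearrange = solve-∀
  total≤coord⇒scaledCorner M t (suc (suc zero)) (a , b , c) tot refl =
    case m+[a+[b+c]]≡m⇒a,b,c≡0 M t a b (trans (sym (rearrange M t a b)) tot) of λ where
      (refl , refl , refl) → refl
    where
    rearrange : ∀ M t a b → a + (b + (M + t)) ≡ M + (t + (a + b))
    rearrange = solve-∀

  addAt-cross⇒scaledCorner : ∀ M {i j} p q → i ≢ j → addAt M i p ≡ addAt M j q → total q ≡ M →
    p ≡ scaledCorner M j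
  addAt-cross⇒scaledCorner M {i} {j} p q i≢j eq tot-q =
    total≤coord⇒scaledCorner M (coord j q) j p tot-p coord-p
    where
    open ≡-Reasoning
    tot-p : total p ≡ M
    tot-p = +-cancelˡ-≡ M _ _ (begin
      M + total p             ≡⟨ sym (total-addAt M i p) ⟩
      total (addAt M i p)     ≡⟨ cong total eq ⟩
      total (addAt M j q)     ≡⟨ total-addAt M j q ⟩
      M + total q             ≡⟨ cong (M +_) tot-q ⟩
      M + M                   ∎)
    coord-p : coord j p ≡ M + coord j q
    coord-p = begin
      coord j p               ≡⟨ sym (coord-addAt-≢ M p (λ j≡i → i≢j (sym j≡i))) ⟩
      coord j (addAt M i p)   ≡⟨ cong (coord j) eq ⟩
      coord j (addAt M j q)   ≡⟨ coord-addAt-≡ M j q ⟩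
      M + coord j q           ∎

  -- The cells w = v i j⋯j and w′ = v j i⋯i meet at the vertex F_w(p_j) = F_w′(p_i).
  data Junction : (n : ℕ) → Word n → Fin 3 → Word n → Fin 3 → Set where
    split  : ∀ {n i j w w′} → i ≢ j → w ≡ replicate n j → w′ ≡ replicate n i →
             Junction (suc n) (i ∷ w) j (j ∷ w′) i
    extend : ∀ {n k w c w′ c′} → Junction n w c w′ c′ → Junction (suc n) (k ∷ w) c (k ∷ w′) c′

  Partner : (n : ℕ) → Word n → Fin 3 → Set
  Partner n w c = Σ (Word n) λ w′ → Σ (Fin 3) λ c′ → Junction n w c w′ c′

  junction-vertex : ∀ {n w c w′ c′} → Junction n w c w′ c′ → vertex n w c ≡ vertex n w′ c′
  junction-vertex {suc n} (split {i = i} {j} _ refl refl) = begin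
    addAt (scale n) i (vertex n (replicate n j) j)  ≡⟨ cong (addAt (scale n) i) (vertex-replicate n j) ⟩
    addAt (scale n) i (scaledCorner (scale n) j)    ≡⟨ addAt-comm (scale n) (scale n) i j _ ⟩
    addAt (scale n) j (scaledCorner (scale n) i)    ≡⟨ cong (addAt (scale n) j) (vertex-replicate n i) ⟨
    addAt (scale n) j (vertex n (replicate n i) i)  ∎
    where open ≡-Reasoning
  junction-vertex {suc n} (extend {k = k} J) = cong (addAt (scale n) k) (junction-vertex J)

  vertex-coincidence : ∀ n w c w′ c′ → vertex n w c ≡ vertex n w′ c′ →
    (w ≡ w′ × c ≡ c′) ⊎ Junction n w c w′ c′
  vertex-coincidence zero    []      c []        c′ eq = inj₁ (refl , corner-injective c c′ eq)
  vertex-coincidence (suc n) (i ∷ w) c (j ∷ w′) c′ eq with i Fin.≟ j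
  ... | yes refl with vertex-coincidence n w c w′ c′ (addAt-injective (scale n) i eq)
  ...   | inj₁ (refl , refl) = inj₁ (refl , refl)
  ...   | inj₂ J             = inj₂ (extend J)
  vertex-coincidence (suc n) (i ∷ w) c (j ∷ w′) c′ eq | no i≢j
    with vertex≡scaledCorner⇒ n w c j
           (addAt-cross⇒scaledCorner (scale n) _ _ i≢j eq (total-vertex n w′ c′))
       | vertex≡scaledCorner⇒ n w′ c′ i
           (addAt-cross⇒scaledCorner (scale n) _ _ (λ j≡i → i≢j (sym j≡i)) (sym eq) (total-vertex n w c))
  ... | w≡jⁿ , refl | w′≡iⁿ , refl = inj₂ (split i≢j w≡jⁿ w′≡iⁿ)

  junction-sym : ∀ {n w c w′ c′} → Junction n w c w′ c′ → Junction n w′ c′ w c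
  junction-sym (split i≢j w≡ w′≡) = split (λ j≡i → i≢j (sym j≡i)) w′≡ w≡
  junction-sym (extend J)         = extend (junction-sym J)

  junction-cells-distinct : ∀ {n w c w′ c′} → Junction n w c w′ c′ → w ≢ w′
  junction-cells-distinct (split i≢j _ _) eq = i≢j (∷-injectiveˡ eq)
  junction-cells-distinct (extend J)      eq = junction-cells-distinct J (∷-injectiveʳ eq)

  junction-corners-distinct : ∀ {n w c w′ c′} → Junction n w c w′ c′ → c ≢ c′
  junction-corners-distinct (split i≢j _ _) eq = i≢j (sym eq)
  junction-corners-distinct (extend J)         = junction-corners-distinct J

  junction-not-extreme : ∀ {n w c w′ c′} → Junction n w c w′ c′ → w ≢ replicate n c
  junction-not-extreme (split i≢j _ _) eq = i≢j (∷-injectiveˡ eq)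
  junction-not-extreme (extend J)      eq = junction-not-extreme J (∷-injectiveʳ eq)

  partner-unique : ∀ {n w c w₁ c₁ w₂ c₂} → Junction n w c w₁ c₁ → Junction n w c w₂ c₂ → w₁ ≡ w₂ × c₁ ≡ c₂
  partner-unique (split _ _ w₁≡) (split _ _ w₂≡) = cong (_ ∷_) (trans w₁≡ (sym w₂≡)) , refl
  partner-unique (split _ w≡ _)  (extend J)      = ⊥-elim (junction-not-extreme J w≡)
  partner-unique (extend J)      (split _ w≡ _)  = ⊥-elim (junction-not-extreme J w≡)
  partner-unique (extend J₁)     (extend J₂) with refl , refl ← partner-unique J₁ J₂ = refl , refl

  junction-corner-unique : ∀ {n w c c′ w′ d d′} → Junction n w c w′ d → Junction n w c′ w′ d′ → c ≡ c′
  junction-corner-unique (split _ _ _)   (split _ _ _)   = refl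
  junction-corner-unique (split i≢j _ _) (extend _)      = ⊥-elim (i≢j refl)
  junction-corner-unique (extend _)      (split i≢j _ _) = ⊥-elim (i≢j refl)
  junction-corner-unique (extend J)      (extend J′)     = junction-corner-unique J J′

  junction-last : ∀ n (u : Word n) {a b} → a ≢ b → Junction (suc n) (u ∷ʳ a) b (u ∷ʳ b) a
  junction-last zero    []      a≢b = split a≢b refl refl
  junction-last (suc n) (k ∷ u) a≢b = extend (junction-last n u a≢b)

  partner? : ∀ n w c → Dec (Partner n w c)
  partner? zero    []      c = no λ ()
  partner? (suc n) (i ∷ w) c with ≡-dec Fin._≟_ w (replicate n c) | i Fin.≟ c
  ... | yes w≡cⁿ | no i≢c  = yes (c ∷ replicate n i , i , split i≢c w≡cⁿ refl)
  ... | yes w≡cⁿ | yes refl = no λ where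
    (_ , _ , split i≢i _ _) → i≢i refl
    (_ , _ , extend J)      → junction-not-extreme J w≡cⁿ
  ... | no w≢cⁿ | _ with partner? n w c
  ...   | yes (w′ , c′ , J) = yes (i ∷ w′ , c′ , extend J)
  ...   | no ¬J = no λ where
    (_ , _ , split _ w≡cⁿ _) → w≢cⁿ w≡cⁿ
    (_ , _ , extend J)       → ¬J (_ , _ , J)

  vertex-injective : ∀ n w {j k} → vertex n w j ≡ vertex n w k → j ≡ k
  vertex-injective n w eq with vertex-coincidence n w _ w _ eq
  ... | inj₁ (_ , j≡k) = j≡k
  ... | inj₂ J         = ⊥-elim (junction-cells-distinct J refl)

  _⊕_ : Pt → Pt → Pt
  (a , b , c) ⊕ (a′ , b′ , c′) = (a + a′ , b + b′ , c + c′)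

  addAt-⊕ : ∀ m j p q → addAt m j (p ⊕ q) ≡ p ⊕ addAt m j q
  addAt-⊕ m zero             (a , b , c) (a′ , b′ , c′) = cong (_, b + b′ , c + c′) (x∙yz≈y∙xz m a a′)
  addAt-⊕ m (suc zero)       (a , b , c) (a′ , b′ , c′) = cong (λ z → a + a′ , z , c + c′) (x∙yz≈y∙xz m b b′)
  addAt-⊕ m (suc (suc zero)) (a , b , c) (a′ , b′ , c′) = cong (λ z → a + a′ , b + b′ , z) (x∙yz≈y∙xz m c c′)

  ⊕-cancelˡ : ∀ p {q q′} → p ⊕ q ≡ p ⊕ q′ → q ≡ q′
  ⊕-cancelˡ (a , b , c) {x , y , z} {x′ , y′ , z′} eq
    with refl ← +-cancelˡ-≡ a x x′ (cong (coord zero) eq)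
       | refl ← +-cancelˡ-≡ b y y′ (cong (coord (suc zero)) eq)
       | refl ← +-cancelˡ-≡ c z z′ (cong (coord (suc (suc zero))) eq) = refl

  F-translation : ∀ n w p → F n w p ≡ p ⊕ F n w (0 , 0 , 0)
  F-translation zero    []      (a , b , c) =
    sym (cong₂ _,_ (+-identityʳ a) (cong₂ _,_ (+-identityʳ b) (+-identityʳ c)))
  F-translation (suc n) (j ∷ w) p =
    trans (cong (addAt (scale n) j) (F-translation n w p)) (addAt-⊕ (scale n) j p _)

  F-agree-elsewhere : ∀ n {w w′} p q → F n w p ≡ F n w′ p → F n w q ≡ F n w′ q
  F-agree-elsewhere n {w} {w′} p q eq = begin
    F n w q                ≡⟨ F-translation n w q ⟩
    q ⊕ F n w (0 , 0 , 0)  ≡⟨ cong (q ⊕_) (⊕-cancelˡ p (begin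
      p ⊕ F n w (0 , 0 , 0)  ≡⟨ F-translation n w p ⟨
      F n w p                ≡⟨ eq ⟩
      F n w′ p               ≡⟨ F-translation n w′ p ⟩
      p ⊕ F n w′ (0 , 0 , 0) ∎)) ⟩
    q ⊕ F n w′ (0 , 0 , 0) ≡⟨ F-translation n w′ q ⟨
    F n w′ q               ∎
    where open ≡-Reasoning

  barycentre-injective : ∀ n {w w′} → F n w p₀ ≡ F n w′ p₀ → w ≡ w′
  barycentre-injective n {w} {w′} eq
    with vertex-coincidence n w zero w′ zero (F-agree-elsewhere n p₀ (corner zero) eq)
  ... | inj₁ (w≡w′ , _) = w≡w′
  ... | inj₂ J          = ⊥-elim (junction-corners-distinct J refl)

  ∈-words : ∀ n (w : Word n) → w ∈ words n
  ∈-words zero    []      = here refl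
  ∈-words (suc n) (j ∷ w) = ∈-concatMap⁺ (λ i → map (i ∷_) (words n))
    (Any.map (λ { refl → ∈-map⁺ (j ∷_) (∈-words n w) }) (∈-allFin j))

  ∈-dedup⁻ : ∀ {z xs} → z ∈ dedup xs → z ∈ xs
  ∈-dedup⁻ = Equivalence.from (deduplicate-∈⇔ _≟Pt_)

  ∈-dedup⁺ : ∀ {z xs} → z ∈ xs → z ∈ dedup xs
  ∈-dedup⁺ = Equivalence.to (deduplicate-∈⇔ _≟Pt_)

  unique-same-members⇒↭ : ∀ {xs ys : List Pt} → Unique xs → Unique ys →
    (∀ {z} → z ∈ xs → z ∈ ys) → (∀ {z} → z ∈ ys → z ∈ xs) → xs ↭ ys
  unique-same-members⇒↭ xs! ys! xs⊆ys ys⊆xs = ∼bag⇒↭ (unique∧set⇒bag xs! ys! (mk⇔ xs⊆ys ys⊆xs))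

  cellVertices : (n : ℕ) → Word n → List Pt
  cellVertices n w = tabulate (vertex n w)

  otherVertices : (n : ℕ) → Word n → Fin 3 → List Pt
  otherVertices n w c = tabulate (vertex n w ∘ punchIn c)

  vertex∈otherVertices : ∀ n w {c k} → k ≢ c → vertex n w k ∈ otherVertices n w c
  vertex∈otherVertices n w {c} k≢c =
    subst (λ k → vertex n w k ∈ otherVertices n w c) (punchIn-punchOut (λ c≡k → k≢c (sym c≡k)))
      (∈-tabulate⁺ {f = vertex n w ∘ punchIn c} _)

  otherVertices-unique : ∀ n w c → Unique (otherVertices n w c)
  otherVertices-unique n w c = Unique.tabulate⁺ (punchIn-injective c _ _ ∘ vertex-injective n w)

  cellVertices-unique : ∀ n w → Unique (cellVertices n w)
  cellVertices-unique n w = Unique.tabulate⁺ (vertex-injective n w)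

  cellVertices-↭ : ∀ n w c → cellVertices n w ↭ vertex n w c ∷ otherVertices n w c
  cellVertices-↭ n w c =
    unique-same-members⇒↭ (cellVertices-unique n w) (distinct-from-others ∷ otherVertices-unique n w c)
      to from
    where
    distinct-from-others : All (vertex n w c ≢_) (otherVertices n w c)
    distinct-from-others = All.tabulate⁺ λ i eq → punchInᵢ≢i c i (sym (vertex-injective n w eq))
    to : ∀ {z} → z ∈ cellVertices n w → z ∈ vertex n w c ∷ otherVertices n w c
    to z∈ with ∈-tabulate⁻ {f = vertex n w} z∈
    ... | k , refl with k Fin.≟ c
    ...   | yes refl = here refl
    ...   | no k≢c   = there (vertex∈otherVertices n w k≢c)
    from : ∀ {z} → z ∈ vertex n w c ∷ otherVertices n w c → z ∈ cellVertices n w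
    from (here refl) = ∈-tabulate⁺ {f = vertex n w} c
    from (there z∈) with ∈-tabulate⁻ {f = vertex n w ∘ punchIn c} z∈
    ... | i , refl = ∈-tabulate⁺ {f = vertex n w} (punchIn c i)

  nbrJ-↭-cellVertices : ∀ n w → nbrJ n (F n w p₀) ↭ cellVertices n w
  nbrJ-↭-cellVertices n w = unique-same-members⇒↭ (deduplicate-! _) (cellVertices-unique n w) to from
    where
    cellOf : Word n → List Pt
    cellOf w′ = filter (λ _ → F n w′ p₀ ≟Pt F n w p₀) (map (λ j → F n w′ (corner j)) fins)
    to : ∀ {z} → z ∈ nbrJ n (F n w p₀) → z ∈ cellVertices n w
    to z∈ with w′ , _ , z∈cell ← find (∈-concatMap⁻ cellOf {xs = words n} (∈-dedup⁻ z∈))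
         with z∈vs , eq ← ∈-filter⁻ (λ _ → F n w′ p₀ ≟Pt F n w p₀) z∈cell
         with j , _ , refl ← ∈-map⁻ (λ j → F n w′ (corner j)) {xs = fins} z∈vs
         with refl ← barycentre-injective n eq = ∈-tabulate⁺ {f = vertex n w} j
    from : ∀ {z} → z ∈ cellVertices n w → z ∈ nbrJ n (F n w p₀)
    from z∈ with j , refl ← ∈-tabulate⁻ {f = vertex n w} z∈ =
      ∈-dedup⁺ (∈-concatMap⁺ cellOf (Any.map (λ { refl →
        ∈-filter⁺ (λ _ → F n w p₀ ≟Pt F n w p₀) (∈-map⁺ (vertex n w) (∈-allFin j)) refl }) (∈-words n w)))

  -- nbrG n x unfolds to dedup (filter (_≢ x) (concatMap (cellVerticesIfContains n x) (words n))).
  cellVerticesIf : (n : ℕ) → Pt → Word n → Fin 3 → List Pt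
  cellVerticesIf n x w j = filter (λ _ → vertex n w j ≟Pt x) (map (vertex n w) fins)

  cellVerticesIfContains : (n : ℕ) → Pt → Word n → List Pt
  cellVerticesIfContains n x w = concatMap (cellVerticesIf n x w) fins

  ∈-nbrG⁻ : ∀ n x {y} → y ∈ nbrG n x →
    y ≢ x × Σ (Word n) λ w → Σ (Fin 3) λ j → Σ (Fin 3) λ k → vertex n w j ≡ x × y ≡ vertex n w k
  ∈-nbrG⁻ n x y∈
    with y∈cells , y≢x ← ∈-filter⁻ (λ y → ¬? (y ≟Pt x)) {xs = concatMap (cellVerticesIfContains n x) (words n)}
                                   (∈-dedup⁻ y∈)
    with w , _ , y∈cell ← find (∈-concatMap⁻ (cellVerticesIfContains n x) {xs = words n} y∈cells)
    with j , _ , y∈vs ← find (∈-concatMap⁻ (cellVerticesIf n x w) {xs = fins} y∈cell)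
    with y∈map , eq ← ∈-filter⁻ (λ _ → vertex n w j ≟Pt x) {xs = map (vertex n w) fins} y∈vs
    with k , _ , refl ← ∈-map⁻ (vertex n w) {xs = fins} y∈map = y≢x , w , j , k , eq , refl

  ∈-nbrG⁺ : ∀ n {x y} w j k → y ≢ x → vertex n w j ≡ x → y ≡ vertex n w k → y ∈ nbrG n x
  ∈-nbrG⁺ n {x} w j k y≢x eq refl =
    ∈-dedup⁺ (∈-filter⁺ (λ y → ¬? (y ≟Pt x))
      (∈-concatMap⁺ (cellVerticesIfContains n x) (Any.map (λ { refl →
        ∈-concatMap⁺ (cellVerticesIf n x w) (Any.map (λ { refl →
          ∈-filter⁺ (λ _ → vertex n w j ≟Pt x) (∈-map⁺ (vertex n w) (∈-allFin k)) eq }) (∈-allFin j)) })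
        (∈-words n w)))
      y≢x)

  NeighbourAt : (n : ℕ) → Word n → Fin 3 → Pt → Set
  NeighbourAt n w c y =
    y ∈ otherVertices n w c ⊎ Σ (Word n) λ w′ → Σ (Fin 3) λ c′ → Junction n w c w′ c′ × y ∈ otherVertices n w′ c′

  neighbourAt : ∀ n w c {y} w″ j k → y ≢ vertex n w c → vertex n w″ j ≡ vertex n w c → y ≡ vertex n w″ k →
    NeighbourAt n w c y
  neighbourAt n w c w″ j k y≢x eq refl with vertex-coincidence n w″ j w c eq
  ... | inj₁ (refl , refl) = inj₁ (vertex∈otherVertices n w (λ k≡c → y≢x (cong (vertex n w) k≡c)))
  ... | inj₂ J             =
    inj₂ (w″ , j , junction-sym J , vertex∈otherVertices n w″ (λ k≡j → y≢x (trans (cong (vertex n w″) k≡j) eq)))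

  ∈-nbrG-vertex⁻ : ∀ n w c {y} → y ∈ nbrG n (vertex n w c) → NeighbourAt n w c y
  ∈-nbrG-vertex⁻ n w c y∈ =
    let y≢x , w″ , j , k , eq , y≡ = ∈-nbrG⁻ n (vertex n w c) y∈ in neighbourAt n w c w″ j k y≢x eq y≡

  ∈-nbrG-vertex⁺ : ∀ n {w c w′ c′ y} → vertex n w′ c′ ≡ vertex n w c → y ∈ otherVertices n w′ c′ →
    y ∈ nbrG n (vertex n w c)
  ∈-nbrG-vertex⁺ n {w′ = w′} {c′} eq y∈ with i , refl ← ∈-tabulate⁻ {f = vertex n w′ ∘ punchIn c′} y∈ =
    ∈-nbrG⁺ n w′ c′ (punchIn c′ i) (λ y≡x → punchInᵢ≢i c′ i (vertex-injective n w′ (trans y≡x (sym eq))))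
      eq refl

  nbrG-unique : ∀ n x → Unique (nbrG n x)
  nbrG-unique n x = deduplicate-! _

  nbrG-unshared-↭ : ∀ n w c → ¬ Partner n w c → nbrG n (vertex n w c) ↭ otherVertices n w c
  nbrG-unshared-↭ n w c no-partner =
    unique-same-members⇒↭ (nbrG-unique n (vertex n w c)) (otherVertices-unique n w c)
      (own-cell ∘ ∈-nbrG-vertex⁻ n w c) (∈-nbrG-vertex⁺ n refl)
    where
    own-cell : ∀ {y} → NeighbourAt n w c y → y ∈ otherVertices n w c
    own-cell (inj₁ y∈)               = y∈
    own-cell (inj₂ (w′ , c′ , J , _)) = ⊥-elim (no-partner (w′ , c′ , J))

  junction-otherVertices-disjoint : ∀ {n w c w′ c′} → Junction n w c w′ c′ →
    Disjoint (otherVertices n w c) (otherVertices n w′ c′)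
  junction-otherVertices-disjoint {n} {w} {c} {w′} {c′} J (y∈ , y∈′)
    with i , refl ← ∈-tabulate⁻ {f = vertex n w ∘ punchIn c} y∈
    with i′ , eq ← ∈-tabulate⁻ {f = vertex n w′ ∘ punchIn c′} y∈′
    with vertex-coincidence n w (punchIn c i) w′ (punchIn c′ i′) eq
  ... | inj₁ (w≡w′ , _) = junction-cells-distinct J w≡w′
  ... | inj₂ J′         = punchInᵢ≢i c i (sym (junction-corner-unique J J′))

  nbrG-junction-↭ : ∀ n w c w′ c′ → Junction n w c w′ c′ →
    nbrG n (vertex n w c) ↭ otherVertices n w c ++ otherVertices n w′ c′
  nbrG-junction-↭ n w c w′ c′ J = unique-same-members⇒↭ (nbrG-unique n (vertex n w c))
    (Unique.++⁺ (otherVertices-unique n w c) (otherVertices-unique n w′ c′)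
                (junction-otherVertices-disjoint J))
    (both-cells ∘ ∈-nbrG-vertex⁻ n w c)
    (λ y∈ → [ ∈-nbrG-vertex⁺ n refl , ∈-nbrG-vertex⁺ n (sym (junction-vertex J)) ]′
              (∈-++⁻ (otherVertices n w c) y∈))
    where
    both-cells : ∀ {y} → NeighbourAt n w c y → y ∈ otherVertices n w c ++ otherVertices n w′ c′
    both-cells (inj₁ y∈)              = ∈-++⁺ˡ y∈
    both-cells (inj₂ (_ , _ , J′ , y∈)) with refl , refl ← partner-unique J J′ =
      ∈-++⁺ʳ (otherVertices n w c) y∈

open Geometry

module Spectral {c ℓ} (K : Char0Field c ℓ) where

  open Char0Field K hiding (zero)
  open import Algebra.Bundles using (CommutativeRing)
  open import Data.Nat as ℕ using (suc)
  open import Relation.Nullary using (¬_; yes; no)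
  open import Data.Fin using (zero; suc; punchIn)
  open import Data.Fin.Properties using (punchInᵢ≢i; punchIn-injective; 0≢1+n)
  open import Data.Vec using ([]; _∷ʳ_; initLast)
  open import Data.Product using (_,_)
  open import Function using (_∘_)
  open import Data.List using ([]; _∷_; map; length; _++_)
  open import Data.List.Relation.Binary.Permutation.Propositional as ↭ using (_↭_)
  open import Data.List.Relation.Binary.Permutation.Propositional.Properties using (map⁺; ↭-length)
  open import Relation.Binary.PropositionalEquality as ≡ using (_≡_; _≢_)
  open import Function.Bundles using (_⇔_; mk⇔; Equivalence)
  open import Relation.Binary.Reasoning.Setoid setoid
  open import Algebra.Properties.Ring (CommutativeRing.ring commRing)
    using (-‿distribˡ-*; -‿distribʳ-*; -‿+-comm)
  open import Algebra.Properties.Group +-group using (x∙y⁻¹≈ε⇒x≈y; x≈y⇒x∙y⁻¹≈ε; ε⁻¹≈ε; ⁻¹-involutive)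
  import Algebra.Properties.CommutativeSemigroup as CommSemigroup
  open CommSemigroup +-commutativeSemigroup
    using () renaming (x∙yz≈y∙xz to x+yz≈y+xz; interchange to +-interchange)
  open CommSemigroup *-commutativeSemigroup
    using () renaming (x∙yz≈y∙xz to x*yz≈y*xz; interchange to *-interchange)

  ι-suc-* : ∀ k x → ι (suc k) * x ≈ x + ι k * x
  ι-suc-* k x = trans (distribʳ x 1# (ι k)) (+-congʳ (*-identityˡ x))

  ι-+ : ∀ m n → ι (m ℕ.+ n) ≈ ι m + ι n
  ι-+ ℕ.zero  n = sym (+-identityˡ (ι n))
  ι-+ (suc m) n = trans (+-congˡ (ι-+ m n)) (sym (+-assoc 1# (ι m) (ι n)))

  ι-* : ∀ m n → ι (m ℕ.* n) ≈ ι m * ι n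
  ι-* ℕ.zero  n = sym (zeroˡ (ι n))
  ι-* (suc m) n = begin
    ι (n ℕ.+ m ℕ.* n)     ≈⟨ ι-+ n (m ℕ.* n) ⟩
    ι n + ι (m ℕ.* n)     ≈⟨ +-congˡ (ι-* m n) ⟩
    ι n + ι m * ι n       ≈⟨ ι-suc-* m (ι n) ⟨
    ι (suc m) * ι n       ∎

  ι-1-* : ∀ x → ι 1 * x ≈ x
  ι-1-* x = trans (ι-suc-* 0 x) (trans (+-congˡ (zeroˡ x)) (+-identityʳ x))

  ι-2-* : ∀ x → ι 2 * x ≈ x + x
  ι-2-* x = trans (ι-suc-* 1 x) (+-congˡ (ι-1-* x))

  ι-2≉0 : ¬ (ι 2 ≈ 0#)
  ι-2≉0 = char0 1

  Σ-↭ : ∀ {xs ys} → xs ↭ ys → Σ[ xs ] ≈ Σ[ ys ]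
  Σ-↭ ↭.refl         = refl
  Σ-↭ (↭.prep x p)   = +-congˡ (Σ-↭ p)
  Σ-↭ (↭.swap x y p) = trans (x+yz≈y+xz x y _) (+-congˡ (+-congˡ (Σ-↭ p)))
  Σ-↭ (↭.trans p q)  = trans (Σ-↭ p) (Σ-↭ q)

  Σ-++ : ∀ xs ys → Σ[ xs ++ ys ] ≈ Σ[ xs ] + Σ[ ys ]
  Σ-++ []       ys = sym (+-identityˡ _)
  Σ-++ (x ∷ xs) ys = trans (+-congˡ (Σ-++ xs ys)) (sym (+-assoc _ _ _))

  Σ-map-sub : ∀ {A : Set} (g : A → Carrier) a ys →
    Σ[ map (λ y → g y - a) ys ] ≈ Σ[ map g ys ] - ι (length ys) * a
  Σ-map-sub g a [] = begin
    0#            ≈⟨ ε⁻¹≈ε ⟨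
    - 0#          ≈⟨ -‿cong (zeroˡ a) ⟨
    - (0# * a)    ≈⟨ +-identityˡ _ ⟨
    0# - 0# * a   ∎
  Σ-map-sub g a (y ∷ ys) = begin
    (g y - a) + Σ[ map (λ y → g y - a) ys ]       ≈⟨ +-congˡ (Σ-map-sub g a ys) ⟩
    (g y - a) + (S - ι (length ys) * a)           ≈⟨ +-interchange _ _ _ _ ⟩
    (g y + S) + (- a - ι (length ys) * a)         ≈⟨ +-congˡ (-‿+-comm _ _) ⟩
    (g y + S) - (a + ι (length ys) * a)           ≈⟨ +-congˡ (-‿cong (ι-suc-* (length ys) a)) ⟨
    (g y + S) - ι (suc (length ys)) * a           ∎
    where S = Σ[ map g ys ]

  ⁻¹*≈⇔≈* : ∀ {a T Z} → ¬ (a ≈ 0#) → (a ⁻¹ * T ≈ Z) ⇔ (T ≈ a * Z)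
  ⁻¹*≈⇔≈* {a} {T} {Z} a≉0 = mk⇔ to from
    where
    to : a ⁻¹ * T ≈ Z → T ≈ a * Z
    to eq = begin
      T              ≈⟨ *-identityˡ T ⟨
      1# * T         ≈⟨ *-congʳ (inverse a a≉0) ⟨
      (a * a ⁻¹) * T ≈⟨ *-assoc a (a ⁻¹) T ⟩
      a * (a ⁻¹ * T) ≈⟨ *-congˡ eq ⟩
      a * Z          ∎
    from : T ≈ a * Z → a ⁻¹ * T ≈ Z
    from eq = begin
      a ⁻¹ * T       ≈⟨ *-congˡ eq ⟩
      a ⁻¹ * (a * Z) ≈⟨ *-assoc (a ⁻¹) a Z ⟨
      (a ⁻¹ * a) * Z ≈⟨ *-congʳ (trans (*-comm (a ⁻¹) a) (inverse a a≉0)) ⟩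
      1# * Z         ≈⟨ *-identityˡ Z ⟩
      Z              ∎

  cancel-nonzero : ∀ {a p} → ¬ (a ≈ 0#) → a * p ≈ 0# → p ≈ 0#
  cancel-nonzero {a} {p} a≉0 ap≈0 =
    trans (sym (Equivalence.from (⁻¹*≈⇔≈* a≉0) refl)) (trans (*-congˡ ap≈0) (zeroʳ (a ⁻¹)))

  pairwise-sums-zero⇒zero : ∀ p q r → p + q ≈ 0# → p + r ≈ 0# → q + r ≈ 0# → p ≈ 0#
  pairwise-sums-zero⇒zero p q r p+q≈0 p+r≈0 q+r≈0 = cancel-nonzero ι-2≉0 (begin
    ι 2 * p                               ≈⟨ ι-2-* p ⟩
    p + p                                 ≈⟨ +-identityʳ (p + p) ⟨
    (p + p) + 0#                          ≈⟨ +-congˡ (-‿inverseʳ (q + r)) ⟨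
    (p + p) + ((q + r) - (q + r))         ≈⟨ +-assoc (p + p) (q + r) _ ⟨
    ((p + p) + (q + r)) - (q + r)         ≈⟨ +-congʳ (+-interchange p q p r) ⟨
    ((p + q) + (p + r)) - (q + r)         ≈⟨ +-cong (+-cong p+q≈0 p+r≈0) (-‿cong q+r≈0) ⟩
    (0# + 0#) - 0#                        ≈⟨ x≈y⇒x∙y⁻¹≈ε (+-identityʳ 0#) ⟩
    0#                                    ∎)

  scaled-eigenvalue : ∀ a x → (ι 2 * a) * (minus3/2 K * x) ≈ - (ι 3 * (a * x))
  scaled-eigenvalue a x = begin
    (ι 2 * a) * (- (ι 3 * h) * x)        ≈⟨ *-congˡ (-‿distribˡ-* (ι 3 * h) x) ⟨
    (ι 2 * a) * - ((ι 3 * h) * x)        ≈⟨ -‿distribʳ-* (ι 2 * a) _ ⟨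
    - ((ι 2 * a) * ((ι 3 * h) * x))      ≈⟨ -‿cong (*-interchange (ι 2) a (ι 3 * h) x) ⟩
    - ((ι 2 * (ι 3 * h)) * (a * x))      ≈⟨ -‿cong (*-congʳ (x*yz≈y*xz (ι 2) (ι 3) h)) ⟩
    - ((ι 3 * (ι 2 * h)) * (a * x))      ≈⟨ -‿cong (*-congʳ (*-congˡ (inverse (ι 2) ι-2≉0))) ⟩
    - ((ι 3 * 1#) * (a * x))             ≈⟨ -‿cong (*-congʳ (*-identityʳ (ι 3))) ⟩
    - (ι 3 * (a * x))                    ∎
    where h = ι 2 ⁻¹

  [x-y]+[z+y]≈z+x : ∀ s b z → (s - b) + (z + b) ≈ z + s
  [x-y]+[z+y]≈z+x s b z = begin
    (s - b) + (z + b)   ≈⟨ +-interchange s (- b) z b ⟩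
    (s + z) + (- b + b) ≈⟨ +-congˡ (-‿inverseˡ b) ⟩
    (s + z) + 0#        ≈⟨ +-identityʳ (s + z) ⟩
    s + z               ≈⟨ +-comm s z ⟩
    z + s               ∎

  -- The vertex lies in e + 1 cells, has 2 (e + 1) neighbours, and C is the sum of its cell sums.
  eigen-defect : ∀ {A : Set} (g : A → Carrier) ys e x C → length ys ≡ 2 ℕ.* suc e →
    ι (suc e) * x + Σ[ map g ys ] ≈ C →
    Σ[ map (λ y → g y - x) ys ] - ι (length ys) * (minus3/2 K * x) ≈ C
  eigen-defect g ys e x C len cells = begin
    Σ[ map (λ y → g y - x) ys ] - ι d * (minus3/2 K * x) ≈⟨ +-cong (Σ-map-sub g x ys) (-‿cong eigen-term) ⟩
    (S - ι d * x) - - (ι 3 * z)                ≈⟨ +-cong (+-congˡ (-‿cong degree-term)) (⁻¹-involutive _) ⟩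
    (S - ι 2 * z) + ι 3 * z                    ≈⟨ +-congˡ (ι-suc-* 2 z) ⟩
    (S - ι 2 * z) + (z + ι 2 * z)              ≈⟨ [x-y]+[z+y]≈z+x S (ι 2 * z) z ⟩
    z + S                                      ≈⟨ cells ⟩
    C                                          ∎
    where
    d = length ys
    S = Σ[ map g ys ]
    z = ι (suc e) * x
    ι-d : ι d ≈ ι 2 * ι (suc e)
    ι-d = trans (reflexive (≡.cong ι len)) (ι-* 2 (suc e))
    degree-term : ι d * x ≈ ι 2 * z
    degree-term = trans (*-congʳ ι-d) (*-assoc (ι 2) (ι (suc e)) x)
    eigen-term : ι d * (minus3/2 K * x) ≈ - (ι 3 * z)
    eigen-term = trans (*-congʳ ι-d) (scaled-eigenvalue (ι (suc e)) x)

  eigen⇔ : ∀ {A : Set} (g : A → Carrier) ys e x C → length ys ≡ 2 ℕ.* suc e →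
    ι (suc e) * x + Σ[ map g ys ] ≈ C →
    (ι (length ys) ⁻¹ * Σ[ map (λ y → g y - x) ys ] ≈ minus3/2 K * x) ⇔ (C ≈ 0#)
  eigen⇔ g ys e x C len cells = mk⇔
    (λ eigen → trans (sym defect) (x≈y⇒x∙y⁻¹≈ε (Equivalence.to scale⇔ eigen)))
    (λ C≈0 → Equivalence.from scale⇔ (x∙y⁻¹≈ε⇒x≈y _ _ (trans defect C≈0)))
    where
    defect = eigen-defect g ys e x C len cells
    scale⇔ = ⁻¹*≈⇔≈* (≡.subst (λ d → ¬ (ι d ≈ 0#)) (≡.sym len) (char0 (e ℕ.+ 1 ℕ.* suc e)))

  module _ (f : Pt → Carrier) where

    cellSum : (n : ℕ) → Word n → Carrier
    cellSum n w = Σ[ map f (cellVertices n w) ]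

    cellSum-split : ∀ n w c → cellSum n w ≈ f (vertex n w c) + Σ[ map f (otherVertices n w c) ]
    cellSum-split n w c = Σ-↭ (map⁺ f (cellVertices-↭ n w c))

    Φ₃≈0⇔cellSum≈0 : ∀ n w → (Φ₃ K n f (F n w p₀) ≈ 0#) ⇔ (cellSum n w ≈ 0#)
    Φ₃≈0⇔cellSum≈0 n w = mk⇔
      (λ Φ₃≈0 → trans (sym nbrJ-sum) (trans (Equivalence.to scale⇔ Φ₃≈0) (zeroʳ (ι 3))))
      (λ s≈0 → Equivalence.from scale⇔ (trans nbrJ-sum (trans s≈0 (sym (zeroʳ (ι 3))))))
      where
      nbrJ-sum : Σ[ map f (nbrJ n (F n w p₀)) ] ≈ cellSum n w
      nbrJ-sum = Σ-↭ (map⁺ f (nbrJ-↭-cellVertices n w))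
      scale⇔ = ⁻¹*≈⇔≈* (char0 2)

    Eigen : (n : ℕ) → Pt → Set ℓ
    Eigen n x = ΔG K n f x ≈ minus3/2 K * f x

    eigen-unshared⇔ : ∀ n w c → ¬ Partner n w c → Eigen n (vertex n w c) ⇔ (cellSum n w ≈ 0#)
    eigen-unshared⇔ n w c no-partner = eigen⇔ f (nbrG n x) 0 (f x) (cellSum n w) (↭-length nbrs↭) (begin
      ι 1 * f x + Σ[ map f (nbrG n x) ]            ≈⟨ +-cong (ι-1-* (f x)) (Σ-↭ (map⁺ f nbrs↭)) ⟩
      f x + Σ[ map f (otherVertices n w c) ]       ≈⟨ cellSum-split n w c ⟨
      cellSum n w                                  ∎)
      where
      x = vertex n w c
      nbrs↭ = nbrG-unshared-↭ n w c no-partner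

    eigen-junction⇔ : ∀ n w c w′ c′ → Junction n w c w′ c′ →
      Eigen n (vertex n w c) ⇔ (cellSum n w + cellSum n w′ ≈ 0#)
    eigen-junction⇔ n w c w′ c′ J =
      eigen⇔ f (nbrG n x) 1 (f x) (cellSum n w + cellSum n w′) (↭-length nbrs↭) (begin
      ι 2 * f x + Σ[ map f (nbrG n x) ]            ≈⟨ +-cong (ι-2-* (f x)) (Σ-↭ (map⁺ f nbrs↭)) ⟩
      (f x + f x) + Σ[ map f (others ++ others′) ] ≈⟨ +-congˡ (Σ-++ (map f others) (map f others′)) ⟩
      (f x + f x) + (Σ[ map f others ] + Σ[ map f others′ ])  ≈⟨ +-interchange _ _ _ _ ⟩
      (f x + Σ[ map f others ]) + (f x + Σ[ map f others′ ])  ≈⟨ +-cong (cellSum-split n w c) cellSum-split′ ⟨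
      cellSum n w + cellSum n w′                   ∎)
      where
      x = vertex n w c
      others = otherVertices n w c
      others′ = otherVertices n w′ c′
      nbrs↭ = nbrG-junction-↭ n w c w′ c′ J
      cellSum-split′ : cellSum n w′ ≈ f x + Σ[ map f others′ ]
      cellSum-split′ =
        trans (cellSum-split n w′ c′) (+-congʳ (reflexive (≡.cong f (≡.sym (junction-vertex J)))))

    kernel⇒eigenspace : ∀ n → InKerΦ₃ K n f → InEigenspace K n (minus3/2 K) f
    kernel⇒eigenspace n ker = eigen-at
      where
      cellSum≈0 : ∀ w → cellSum n w ≈ 0#
      cellSum≈0 w = Equivalence.to (Φ₃≈0⇔cellSum≈0 n w) (ker w)
      eigen-at : ∀ w c → Eigen n (vertex n w c)
      eigen-at w c with partner? n w c
      ... | no no-partner     = Equivalence.from (eigen-unshared⇔ n w c no-partner) (cellSum≈0 w)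
      ... | yes (w′ , c′ , J) = Equivalence.from (eigen-junction⇔ n w c w′ c′ J)
                                  (trans (+-cong (cellSum≈0 w) (cellSum≈0 w′)) (+-identityʳ 0#))

    eigenspace⇒cellSum≈0 : ∀ n → InEigenspace K n (minus3/2 K) f → ∀ w → cellSum n w ≈ 0#
    eigenspace⇒cellSum≈0 ℕ.zero  eigen [] = Equivalence.to (eigen-unshared⇔ 0 [] zero λ ()) (eigen [] zero)
    eigenspace⇒cellSum≈0 (suc n) eigen w with u , a , ≡.refl ← initLast w =
      pairwise-sums-zero⇒zero _ _ _
        (meet (punchInᵢ≢i a zero ∘ ≡.sym))
        (meet (punchInᵢ≢i a (suc zero) ∘ ≡.sym))
        (meet (0≢1+n ∘ punchIn-injective a zero (suc zero)))
      where
      meet : ∀ {i j} → i ≢ j → cellSum (suc n) (u ∷ʳ i) + cellSum (suc n) (u ∷ʳ j) ≈ 0#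
      meet {i} {j} i≢j =
        Equivalence.to (eigen-junction⇔ (suc n) (u ∷ʳ i) j (u ∷ʳ j) i (junction-last n u i≢j))
          (eigen (u ∷ʳ i) j)

    eigenspace⇒kernel : ∀ n → InEigenspace K n (minus3/2 K) f → InKerΦ₃ K n f
    eigenspace⇒kernel n eigen w = Equivalence.from (Φ₃≈0⇔cellSum≈0 n w) (eigenspace⇒cellSum≈0 n eigen w)

corollary6p3 : ∀ {c ℓ} (K : Char0Field c ℓ) (n : ℕ) (f : Pt → Char0Field.Carrier K) →
    (InKerΦ₃ K n f → InEigenspace K n (minus3/2 K) f) × (InEigenspace K n (minus3/2 K) f → InKerΦ₃ K n f)
corollary6p3 K n f = kernel⇒eigenspace f n , eigenspace⇒kernel f n
  where open Spectral K
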